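{- Let $\mathcal{X}=(V,S)$ be a Higmanian scheme with standard ordering $S=\{s_0,\dots,s_4\}$. Then the following conditions are equivalent: (a) $c_{33}^3=c_{33}^4$; (b) $c_{43}^3=c_{43}^4$; (c) $c_{44}^3=c_{44}^4$; (d) $\tau=\dfrac{\varepsilon\gamma(\alpha-\gamma)}{\alpha}$, where $$\alpha=n_1+1,\quad \beta=\frac{n_2}{n_1+1},\quad \gamma=\frac{n_3(n_1+1)}{n_3+n_4},\quad \delta=\frac{n_3+n_4}{n_1+1},\quad \varepsilon=\delta-\beta-1,\quad \tau=c_{43}^4.$$
   Context: An association scheme on a finite set $V$ is a pair $\mathcal{X}=(V,S)$, where $S$ is a partition of $V^2$ such that the diagonal $\mathbf{1}_V$ belongs to $S$, $s^*=\{(y,x):(x,y)\in s\}\in S$ for all $s\in S$, and for all $r,s,t\in S$ the number $c_{rs}^t=|xr\cap ys^*|$ (where $xr=\{y:(x,y)\in r\}$) does not depend on $(x,y)\in t$. The valency of a union $r$ of basis relations is $n_r=|xr|$. A parabolic is an equivalence relation on $V$ which is a union of elements of $S$. For $s\subseteq V^2$, $\mathrm{rad}(s)$ is the largest relation $r\subseteq V^2$ with $rs=sr=s$. $\mathcal{X}$ is Higmanian if $|S|=5$, $s^*=s$ for all $s\in S$, there exist $s_1,s_2\in S$ such that $e_0=\mathbf{1}_V\cup s_1$ and $e_1=\mathbf{1}_V\cup s_1\cup s_2$ are parabolics, and $\mathrm{rad}(s)=\mathbf{1}_V$ for every $s\in S$ not contained in $e_1$. A standard ordering is $S=\{s_0,\dots,s_4\}$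 with $s_0=\mathbf{1}_V$, $s_1=e_0\setminus\mathbf{1}_V$, $s_2=e_1\setminus e_0$, $n_3\le n_4$, where $n_j=n_{s_j}$; $c_{jk}^l=c_{s_js_k}^{s_l}$. -}

module Defs where

open import Data.Nat as ℕ using (ℕ; zero; suc)
open import Data.Integer as ℤ using (ℤ; +_)
open import Data.Rational as ℚ using (ℚ)
open import Data.Fin using (Fin; zero; suc)
open import Data.Fin.Properties using (_≟_)
open import Data.Bool using (Bool; true; false; _∧_; if_then_else_)
open import Data.Product using (Σ; _×_; _,_; proj₁; proj₂; ∃)
open import Data.Sum using (_⊎_)
open import Relation.Nullary.Decidable using (⌊_⌋)
open import Relation.Binary.PropositionalEquality using (_≡_)
open import Function.Bundles using (_⇔_)

count : ∀ {n} → (Fin n → Bool) → ℕ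
count {zero}  P = 0
count {suc n} P = (if P zero then 1 else 0) ℕ.+ count {n} (λ i → P (suc i))

-- For a labelling R : V × V → Fin k of pairs by basis relations,
-- |x r ∩ y s*| = #{ z : (x,z) ∈ r and (z,y) ∈ s }
cnt : ∀ {n k} → (Fin n → Fin n → Fin k) → Fin k → Fin k → Fin n → Fin n → ℕ
cnt R r s x y = count (λ z → ⌊ R x z ≟ r ⌋ ∧ ⌊ R z y ≟ s ⌋)

-- An association scheme on V = Fin n with basis relations s_0,…,s_k,
-- encoded by the map R sending (x,y) to the index of the basis relation containing it.
record Scheme (n k : ℕ) : Set where
  field
    R         : Fin n → Fin n → Fin (suc k)
    nonempty  : (s : Fin (suc k)) → Σ (Fin n × Fin n) (λ p → R (proj₁ p) (proj₂ p) ≡ s)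
    diagonal  : ∀ x y → (R x y ≡ zero) ⇔ (x ≡ y)
    transpose : ∀ s → Σ (Fin (suc k)) (λ s′ → ∀ x y → R x y ≡ s → R y x ≡ s′)
    regular   : ∀ r s t x y x′ y′ → R x y ≡ t → R x′ y′ ≡ t →
                cnt R r s x y ≡ cnt R r s x′ y′

  -- intersection number c_{rs}^t, evaluated at a chosen pair (x,y) ∈ t
  c : Fin (suc k) → Fin (suc k) → Fin (suc k) → ℕ
  c r s t = cnt R r s (proj₁ (proj₁ (nonempty t))) (proj₂ (proj₁ (nonempty t)))

  pt : Fin n
  pt = proj₁ (proj₁ (nonempty zero))

  val : Fin (suc k) → ℕ
  val s = count (λ z → ⌊ R pt z ≟ s ⌋)

  Parabolic : (Fin (suc k) → Set) → Set
  Parabolic U = (∀ x → U (R x x))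
              × (∀ x y → U (R x y) → U (R y x))
              × (∀ x y z → U (R x y) → U (R y z) → U (R x z))

  Rel : Set₁
  Rel = Fin n → Fin n → Set

  basis : Fin (suc k) → Rel
  basis s x y = R x y ≡ s

  _∘ᵣ_ : Rel → Rel → Rel
  (r ∘ᵣ s) x z = ∃ λ y → r x y × s y z

  _≐_ : Rel → Rel → Set
  r ≐ s = ∀ x y → r x y ⇔ s x y

  -- rad(s) = 1_V : every relation r with rs = sr = s is contained in the diagonal
  -- (the diagonal itself always satisfies rs = sr = s, so it is then the largest one)
  RadTrivial : Rel → Set₁
  RadTrivial s = ∀ (r : Rel) → (r ∘ᵣ s) ≐ s → (s ∘ᵣ r) ≐ s → ∀ x y → r x y → x ≡ y

pattern s1 = suc zero
pattern s2 = suc (suc zero)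
pattern s3 = suc (suc (suc zero))
pattern s4 = suc (suc (suc (suc zero)))

record HigmanianStd {n : ℕ} (X : Scheme n 4) : Set₁ where
  open Scheme X
  field
    symmetric : ∀ x y → R x y ≡ R y x
    e₀-parabolic : Parabolic (λ i → i ≡ zero ⊎ i ≡ s1)
    e₁-parabolic : Parabolic (λ i → i ≡ zero ⊎ i ≡ s1 ⊎ i ≡ s2)
    rad₃ : RadTrivial (basis s3)
    rad₄ : RadTrivial (basis s4)
    n₃≤n₄ : val s3 ℕ.≤ val s4

-- division of a natural by a natural, as a rational; only used with nonzero denominators
_/ₜ_ : ℕ → ℕ → ℚ
a /ₜ zero = ℚ.0ℚ
a /ₜ suc d = (+ a) ℚ./ suc d

module Params {n : ℕ} (X : Scheme n 4) where
  open Scheme X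
  n₁ n₂ n₃ n₄ : ℕ
  n₁ = val s1
  n₂ = val s2
  n₃ = val s3
  n₄ = val s4

  α β γ δ ε τ : ℚ
  α = (+ suc n₁) ℚ./ 1
  β = n₂ /ₜ suc n₁
  γ = (n₃ ℕ.* suc n₁) /ₜ (n₃ ℕ.+ n₄)
  δ = (n₃ ℕ.+ n₄) /ₜ suc n₁
  ε = δ ℚ.- β ℚ.- ℚ.1ℚ
  τ = (+ c s4 s3 s4) ℚ./ 1

  CondD : Set
  CondD = τ ≡ ((ε ℚ.* γ ℚ.* (α ℚ.- γ)) ℚ.* (1 /ₜ suc n₁))

module Submission where

-- Write e₁ = s₀ ∪ s₁ ∪ s₂ and let c_{e₁s}ᵗ count the z ∈ x e₁ with (z, y) ∈ s, for (x, y) ∈ s_t.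
-- For t ∈ {3, 4}, splitting y s₃ and y s₄ along the basis relations gives
-- c_{e₁3}ᵗ + c₃₃ᵗ + c₄₃ᵗ = n₃ and c_{e₁4}ᵗ + c₃₄ᵗ + c₄₄ᵗ = n₄, and splitting x e₁ gives
-- c_{e₁3}ᵗ + c_{e₁4}ᵗ = n₁ + n₂ + 1, since the equivalence relation e₁ does not contain (x, y).
-- If c_{e₁3}⁴ were 0, then e₁ s₃ = s₃ e₁ = s₃, so e₁ ⊆ rad(s₃) = 1_V, which is absurd. A point
-- w ∈ x e₁ with (w, y) ∈ s₃, for (x, y) ∈ s₄, then gives c_{e₁3}⁴ = c_{e₁3}³ because x e₁ = w e₁;
-- hence also c_{e₁4}⁴ = c_{e₁4}³, and (a) ⇔ (b) ⇔ (c) follow by cancellation. Double counting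
-- gives n₄ c₃₃⁴ = n₃ c₄₃³ and n₄ c_{e₁3}⁴ = n₃ c_{e₁4}³; with these, (b) is (d) with its
-- denominators cleared.

open import Defs
open import Data.Bool using (Bool; true; false; _∧_; if_then_else_)
open import Data.Bool.Properties using (∧-comm; ∧-assoc; ∧-idem; ∧-identityʳ)
open import Data.Empty using (⊥; ⊥-elim)
open import Data.Fin using (Fin; zero; suc)
open import Data.Fin.Properties using (_≟_; 0≢1+n)
open import Data.Integer as ℤ using ()
import Data.Integer.Properties as ℤₚ
open import Data.Nat using (ℕ; zero; suc; _+_; _*_; ≢-nonZero)
import Data.Nat.Properties as ℕₚ
open import Algebra.Properties.Semiring.Sum ℕₚ.+-*-semiring
  using (sum-syntax; ∑-distrib-+; ∑-comm; sum-cong-≗; sum-replicate-zero; *-distribˡ-sum; *-distribʳ-sum)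
open import Data.Nat.Solver using (module +-*-Solver)
open import Data.Product using (_×_; _,_; proj₁; proj₂; ∃)
open import Data.Rational as ℚ using (ℚ; 1ℚ; toℚᵘ)
open import Data.Rational.Properties using (toℚᵘ-injective; toℚᵘ-fromℚᵘ; toℚᵘ-homo-*; toℚᵘ-homo-+; toℚᵘ-cong)
import Data.Rational.Solver as ℚ-Solver
open import Data.Rational.Unnormalised as ℚᵘ using (mkℚᵘ; *≡*)
import Data.Rational.Unnormalised.Properties as ℚᵘₚ
open import Data.Sum using (_⊎_; inj₁; inj₂)
open import Function.Base using (_∘_; id)
open import Function.Bundles using (_⇔_; Equivalence; mk⇔)
open import Function.Properties.Equivalence using () renaming (trans to ⇔-trans; sym to ⇔-sym)
open import Function.Related.Propositional as Related using ()
open import Relation.Binary.PropositionalEquality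
open import Relation.Nullary using (Dec; yes; no)
open import Relation.Nullary.Decidable using (⌊_⌋; ⌊⌋-map′; isYes≗does; dec-true; does-⇔)

𝟙 : Bool → ℕ
𝟙 b = if b then 1 else 0

≟-sound : ∀ {m} {i j : Fin m} → ⌊ i ≟ j ⌋ ≡ true → i ≡ j
≟-sound {i = i} {j} ⌊i≟j⌋ with i ≟ j
... | yes i≡j = i≡j
≟-sound () | no _

≟-refl : ∀ {m} (i : Fin m) → ⌊ i ≟ i ⌋ ≡ true
≟-refl i = trans (isYes≗does (i ≟ i)) (dec-true (i ≟ i) refl)

⌊⌋-⇔ : ∀ {a b} {A : Set a} {B : Set b} → A ⇔ B → (a? : Dec A) (b? : Dec B) → ⌊ a? ⌋ ≡ ⌊ b? ⌋
⌊⌋-⇔ A⇔B a? b? = trans (isYes≗does a?) (trans (does-⇔ A⇔B a? b?) (sym (isYes≗does b?)))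

∧-true : ∀ a {b} → a ∧ b ≡ true → a ≡ true × b ≡ true
∧-true true {true} _ = refl , refl

bool-ext : ∀ {a b} → (a ≡ true → b ≡ true) → (b ≡ true → a ≡ true) → a ≡ b
bool-ext {true}  {true}  a⇒b b⇒a = refl
bool-ext {true}  {false} a⇒b b⇒a = sym (a⇒b refl)
bool-ext {false} {true}  a⇒b b⇒a = b⇒a refl
bool-ext {false} {false} a⇒b b⇒a = refl

count≡∑ : ∀ {n} (P : Fin n → Bool) → count P ≡ ∑[ z < n ] 𝟙 (P z)
count≡∑ {zero}  P = refl
count≡∑ {suc n} P = cong (𝟙 (P zero) +_) (count≡∑ (λ z → P (suc z)))

count-cong : ∀ {n} {P Q : Fin n → Bool} → (∀ z → P z ≡ Q z) → count P ≡ count Q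
count-cong {zero}  P≗Q = refl
count-cong {suc n} P≗Q = cong₂ _+_ (cong 𝟙 (P≗Q zero)) (count-cong (λ z → P≗Q (suc z)))

count-false : ∀ {n} → count {n} (λ _ → false) ≡ 0
count-false {zero}  = refl
count-false {suc n} = count-false {n}

count-+ : ∀ {n} (P Q T : Fin n → Bool) → (∀ z → 𝟙 (P z) + 𝟙 (Q z) ≡ 𝟙 (T z)) →
          count P + count Q ≡ count T
count-+ P Q T pointwise = begin
  count P + count Q                          ≡⟨ cong₂ _+_ (count≡∑ P) (count≡∑ Q) ⟩
  ∑[ z < _ ] 𝟙 (P z) + ∑[ z < _ ] 𝟙 (Q z)    ≡⟨ sym (∑-distrib-+ (𝟙 ∘ P) (𝟙 ∘ Q)) ⟩
  ∑[ z < _ ] (𝟙 (P z) + 𝟙 (Q z))             ≡⟨ sum-cong-≗ pointwise ⟩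
  ∑[ z < _ ] 𝟙 (T z)                         ≡⟨ sym (count≡∑ T) ⟩
  count T                                    ∎
  where open ≡-Reasoning

count≢0 : ∀ {n} (P : Fin n → Bool) {z} → P z ≡ true → count P ≢ 0
count≢0 P {zero}  Pz≡true rewrite Pz≡true = λ ()
count≢0 P {suc z} Pz≡true with P zero
... | true  = λ ()
... | false = count≢0 (P ∘ suc) Pz≡true

count-witness : ∀ {n} (P : Fin n → Bool) → count P ≢ 0 → ∃ λ z → P z ≡ true
count-witness {zero}  P count≢0 = ⊥-elim (count≢0 refl)
count-witness {suc n} P count≢0 with P zero in eq
... | true  = zero , eq
... | false = let z , Pz = count-witness (P ∘ suc) count≢0 in suc z , Pz

∑-select : ∀ {m} (j : Fin m) (g : Fin m → ℕ) → ∑[ i < m ] (𝟙 ⌊ j ≟ i ⌋ * g i) ≡ g j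
∑-select {suc m} zero g = begin
  (g zero + 0) + ∑[ i < m ] 0 ≡⟨ cong₂ _+_ (ℕₚ.+-identityʳ (g zero)) (sum-replicate-zero m) ⟩
  g zero + 0                  ≡⟨ ℕₚ.+-identityʳ (g zero) ⟩
  g zero                      ∎
  where open ≡-Reasoning
∑-select {suc m} (suc j) g =
  trans (sum-cong-≗ (λ i → cong (λ b → 𝟙 b * g (suc i)) (⌊⌋-map′ _ _ (j ≟ i))))
        (∑-select j (g ∘ suc))

count-single : ∀ {n} (x : Fin n) → count (λ z → ⌊ x ≟ z ⌋) ≡ 1
count-single x = begin
  count (λ z → ⌊ x ≟ z ⌋)      ≡⟨ count≡∑ (λ z → ⌊ x ≟ z ⌋) ⟩
  ∑[ z < _ ] 𝟙 ⌊ x ≟ z ⌋       ≡⟨ sum-cong-≗ (λ z → sym (ℕₚ.*-identityʳ (𝟙 ⌊ x ≟ z ⌋))) ⟩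
  ∑[ z < _ ] (𝟙 ⌊ x ≟ z ⌋ * 1)  ≡⟨ ∑-select x (λ _ → 1) ⟩
  1                            ∎
  where open ≡-Reasoning

𝟙-∧-exchange : ∀ a b c → 𝟙 a * 𝟙 (b ∧ c) ≡ 𝟙 b * 𝟙 (a ∧ c)
𝟙-∧-exchange true  true  c = refl
𝟙-∧-exchange true  false c = refl
𝟙-∧-exchange false true  c = refl
𝟙-∧-exchange false false c = refl

count-fibres : ∀ {n m} (f : Fin n → Fin m) (U : Fin m → Bool) (P : Fin n → Bool) →
               count (λ z → U (f z) ∧ P z) ≡ ∑[ i < m ] (𝟙 (U i) * count (λ z → ⌊ f z ≟ i ⌋ ∧ P z))
count-fibres {n} {m} f U P = begin
  count (λ z → U (f z) ∧ P z)                                     ≡⟨ count≡∑ (λ z → U (f z) ∧ P z) ⟩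
  ∑[ z < n ] 𝟙 (U (f z) ∧ P z)                                    ≡⟨ sum-cong-≗ select ⟩
  ∑[ z < n ] ∑[ i < m ] (𝟙 (U i) * 𝟙 (⌊ f z ≟ i ⌋ ∧ P z))           ≡⟨ ∑-comm (λ z i → 𝟙 (U i) * 𝟙 (⌊ f z ≟ i ⌋ ∧ P z)) ⟩
  ∑[ i < m ] ∑[ z < n ] (𝟙 (U i) * 𝟙 (⌊ f z ≟ i ⌋ ∧ P z))           ≡⟨ sum-cong-≗ (λ i → sym (*-distribˡ-sum (𝟙 (U i)) (λ z → 𝟙 (⌊ f z ≟ i ⌋ ∧ P z)))) ⟩
  ∑[ i < m ] (𝟙 (U i) * ∑[ z < n ] 𝟙 (⌊ f z ≟ i ⌋ ∧ P z))           ≡⟨ sum-cong-≗ (λ i → cong (𝟙 (U i) *_) (sym (count≡∑ (λ z → ⌊ f z ≟ i ⌋ ∧ P z)))) ⟩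
  ∑[ i < m ] (𝟙 (U i) * count (λ z → ⌊ f z ≟ i ⌋ ∧ P z))            ∎
  where
  open ≡-Reasoning
  select : ∀ z → 𝟙 (U (f z) ∧ P z) ≡ ∑[ i < m ] (𝟙 (U i) * 𝟙 (⌊ f z ≟ i ⌋ ∧ P z))
  select z = begin
    𝟙 (U (f z) ∧ P z)                                   ≡⟨ sym (∑-select (f z) (λ i → 𝟙 (U i ∧ P z))) ⟩
    ∑[ i < m ] (𝟙 ⌊ f z ≟ i ⌋ * 𝟙 (U i ∧ P z))            ≡⟨ sum-cong-≗ (λ i → 𝟙-∧-exchange ⌊ f z ≟ i ⌋ (U i) (P z)) ⟩
    ∑[ i < m ] (𝟙 (U i) * 𝟙 (⌊ f z ≟ i ⌋ ∧ P z))          ∎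

count-weighted : ∀ {n} (A : Fin n → Bool) (Q : Fin n → Fin n → Bool) k →
                 (∀ y → A y ≡ true → count (Q y) ≡ k) →
                 count A * k ≡ ∑[ y < n ] count (λ z → A y ∧ Q y z)
count-weighted {n} A Q k count≡k = begin
  count A * k                          ≡⟨ cong (_* k) (count≡∑ A) ⟩
  (∑[ y < n ] 𝟙 (A y)) * k             ≡⟨ *-distribʳ-sum k (𝟙 ∘ A) ⟩
  ∑[ y < n ] (𝟙 (A y) * k)              ≡⟨ sum-cong-≗ weight ⟩
  ∑[ y < n ] count (λ z → A y ∧ Q y z) ∎
  where
  open ≡-Reasoning
  weight : ∀ y → 𝟙 (A y) * k ≡ count (λ z → A y ∧ Q y z)
  weight y with A y in eq
  ... | true  = trans (ℕₚ.+-identityʳ k) (sym (count≡k y eq))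
  ... | false = sym (count-false {n})

count-double : ∀ {n} (A C : Fin n → Bool) (B : Fin n → Fin n → Bool) k₁ k₂ →
               (∀ y → A y ≡ true → count (λ z → B y z ∧ C z) ≡ k₁) →
               (∀ z → C z ≡ true → count (λ y → A y ∧ B y z) ≡ k₂) →
               count A * k₁ ≡ count C * k₂
count-double {n} A C B k₁ k₂ h₁ h₂ = begin
  count A * k₁                                         ≡⟨ count-weighted A (λ y z → B y z ∧ C z) k₁ h₁ ⟩
  ∑[ y < n ] count (λ z → A y ∧ (B y z ∧ C z))         ≡⟨ sum-cong-≗ (λ y → count≡∑ (λ z → A y ∧ (B y z ∧ C z))) ⟩
  ∑[ y < n ] ∑[ z < n ] 𝟙 (A y ∧ (B y z ∧ C z))        ≡⟨ ∑-comm (λ y z → 𝟙 (A y ∧ (B y z ∧ C z))) ⟩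
  ∑[ z < n ] ∑[ y < n ] 𝟙 (A y ∧ (B y z ∧ C z))        ≡⟨ sum-cong-≗ (λ z → sum-cong-≗ (λ y → cong 𝟙 (rotate (A y) (B y z) (C z)))) ⟩
  ∑[ z < n ] ∑[ y < n ] 𝟙 (C z ∧ (A y ∧ B y z))        ≡⟨ sum-cong-≗ (λ z → sym (count≡∑ (λ y → C z ∧ (A y ∧ B y z)))) ⟩
  ∑[ z < n ] count (λ y → C z ∧ (A y ∧ B y z))         ≡⟨ sym (count-weighted C (λ z y → A y ∧ B y z) k₂ h₂) ⟩
  count C * k₂                                         ∎
  where
  open ≡-Reasoning
  rotate : ∀ a b c → a ∧ (b ∧ c) ≡ c ∧ (a ∧ b)
  rotate a b c = trans (sym (∧-assoc a b c)) (∧-comm (a ∧ b) c)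

module SymmetricScheme {n k} (X : Scheme n k) (symmetric : ∀ x y → Scheme.R X x y ≡ Scheme.R X y x) where
  open Scheme X

  ⁅_⁆ : Fin (suc k) → Fin (suc k) → Bool
  ⁅ r ⁆ i = ⌊ i ≟ r ⌋

  x₀ y₀ : Fin (suc k) → Fin n
  x₀ t = proj₁ (proj₁ (nonempty t))
  y₀ t = proj₂ (proj₁ (nonempty t))

  R[x₀,y₀] : ∀ t → R (x₀ t) (y₀ t) ≡ t
  R[x₀,y₀] t = proj₂ (nonempty t)

  -- A predicate U on indices stands for the union of the basis relations it selects;
  -- c⋃ U s t is the intersection number c_{U s}^t, and c⋃ ⁅ r ⁆ s t is c r s t by definition.
  cnt⋃ : (Fin (suc k) → Bool) → Fin (suc k) → Fin n → Fin n → ℕ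
  cnt⋃ U s x y = count (λ z → U (R x z) ∧ ⌊ R z y ≟ s ⌋)

  c⋃ : (Fin (suc k) → Bool) → Fin (suc k) → Fin (suc k) → ℕ
  c⋃ U s t = cnt⋃ U s (x₀ t) (y₀ t)

  R-diagonal : ∀ x → R x x ≡ zero
  R-diagonal x = Equivalence.from (diagonal x x) refl

  ≟-symmetric : ∀ x y s → ⌊ R x y ≟ s ⌋ ≡ ⌊ R y x ≟ s ⌋
  ≟-symmetric x y s = cong (λ i → ⌊ i ≟ s ⌋) (symmetric x y)

  cnt-regular : ∀ r s {t x y} → R x y ≡ t → cnt R r s x y ≡ c r s t
  cnt-regular r s {t} {x} {y} R[x,y] = regular r s t x y (x₀ t) (y₀ t) R[x,y] (R[x₀,y₀] t)

  cnt⋃≡∑ : ∀ U s x y → cnt⋃ U s x y ≡ ∑[ i < suc k ] (𝟙 (U i) * cnt R i s x y)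
  cnt⋃≡∑ U s x y = count-fibres (R x) U (λ z → ⌊ R z y ≟ s ⌋)

  cnt⋃-regular : ∀ U s {t x y} → R x y ≡ t → cnt⋃ U s x y ≡ c⋃ U s t
  cnt⋃-regular U s {t} {x} {y} R[x,y] = begin
    cnt⋃ U s x y                                ≡⟨ cnt⋃≡∑ U s x y ⟩
    ∑[ i < suc k ] (𝟙 (U i) * cnt R i s x y)    ≡⟨ sum-cong-≗ (λ i → cong (𝟙 (U i) *_) (cnt-regular i s R[x,y])) ⟩
    ∑[ i < suc k ] (𝟙 (U i) * c i s t)          ≡⟨ cnt⋃≡∑ U s (x₀ t) (y₀ t) ⟨
    c⋃ U s t                                    ∎
    where open ≡-Reasoning

  valency : ∀ x s → count (λ z → ⌊ R x z ≟ s ⌋) ≡ val s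
  valency x s = trans (via-diagonal x) (sym (via-diagonal pt))
    where
    via-diagonal : ∀ x → count (λ z → ⌊ R x z ≟ s ⌋) ≡ c s s zero
    via-diagonal x = trans (count-cong (λ z → trans (sym (∧-idem ⌊ R x z ≟ s ⌋)) (cong (⌊ R x z ≟ s ⌋ ∧_) (≟-symmetric x z s))))
                           (cnt-regular s s (R-diagonal x))

  valency-diagonal : val zero ≡ 1
  valency-diagonal = trans (count-cong (λ z → ⌊⌋-⇔ (diagonal pt z) (R pt z ≟ zero) (pt ≟ z))) (count-single pt)

  c-comm : ∀ r s t → c r s t ≡ c s r t
  c-comm r s t = trans (count-cong swap) (cnt-regular s r (trans (symmetric (y₀ t) (x₀ t)) (R[x₀,y₀] t)))
    where
    swap : ∀ z → (⌊ R (x₀ t) z ≟ r ⌋ ∧ ⌊ R z (y₀ t) ≟ s ⌋) ≡ (⌊ R (y₀ t) z ≟ s ⌋ ∧ ⌊ R z (x₀ t) ≟ r ⌋)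
    swap z = trans (∧-comm ⌊ R (x₀ t) z ≟ r ⌋ ⌊ R z (y₀ t) ≟ s ⌋) (cong₂ _∧_ (≟-symmetric z (y₀ t) s) (≟-symmetric (x₀ t) z r))

  count⋃-valency : ∀ U x → count (λ z → U (R x z)) ≡ ∑[ i < suc k ] (𝟙 (U i) * val i)
  count⋃-valency U x = begin
    count (λ z → U (R x z))                                      ≡⟨ count-cong (λ z → sym (∧-identityʳ (U (R x z)))) ⟩
    count (λ z → U (R x z) ∧ true)                               ≡⟨ count-fibres (R x) U (λ _ → true) ⟩
    ∑[ i < suc k ] (𝟙 (U i) * count (λ z → ⌊ R x z ≟ i ⌋ ∧ true)) ≡⟨ sum-cong-≗ (λ i → cong (𝟙 (U i) *_) (trans (count-cong (λ z → ∧-identityʳ ⌊ R x z ≟ i ⌋)) (valency x i))) ⟩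
    ∑[ i < suc k ] (𝟙 (U i) * val i)                             ∎
    where open ≡-Reasoning

  ∑c≡val : ∀ s t → ∑[ i < suc k ] c i s t ≡ val s
  ∑c≡val s t = begin
    ∑[ i < suc k ] c i s t                       ≡⟨ sum-cong-≗ (λ i → sym (ℕₚ.*-identityˡ (c i s t))) ⟩
    ∑[ i < suc k ] (𝟙 true * c i s t)            ≡⟨ cnt⋃≡∑ (λ _ → true) s (x₀ t) (y₀ t) ⟨
    count (λ z → ⌊ R z (y₀ t) ≟ s ⌋)             ≡⟨ count-cong (λ z → ≟-symmetric z (y₀ t) s) ⟩
    count (λ z → ⌊ R (y₀ t) z ≟ s ⌋)             ≡⟨ valency (y₀ t) s ⟩
    val s                                        ∎
    where open ≡-Reasoning

  val-*-c⋃ : ∀ U s t → val t * c⋃ U s t ≡ val s * c⋃ U t s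
  val-*-c⋃ U s t = begin
    val t * c⋃ U s t                    ≡⟨ count-double (λ y → ⌊ R pt y ≟ t ⌋) (λ z → ⌊ R z pt ≟ s ⌋) (λ y z → U (R y z)) _ _ count₁ count₂ ⟩
    count (λ z → ⌊ R z pt ≟ s ⌋) * c⋃ U t s  ≡⟨ cong (_* c⋃ U t s) (trans (count-cong (λ z → ≟-symmetric z pt s)) (valency pt s)) ⟩
    val s * c⋃ U t s                    ∎
    where
    open ≡-Reasoning
    count₁ : ∀ y → ⌊ R pt y ≟ t ⌋ ≡ true → cnt⋃ U s y pt ≡ c⋃ U s t
    count₁ y R[pt,y] = cnt⋃-regular U s (trans (symmetric y pt) (≟-sound R[pt,y]))
    count₂ : ∀ z → ⌊ R z pt ≟ s ⌋ ≡ true → count (λ y → ⌊ R pt y ≟ t ⌋ ∧ U (R y z)) ≡ c⋃ U t s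
    count₂ z R[z,pt] = trans (count-cong swap) (cnt⋃-regular U t (≟-sound R[z,pt]))
      where
      swap : ∀ y → (⌊ R pt y ≟ t ⌋ ∧ U (R y z)) ≡ (U (R z y) ∧ ⌊ R y pt ≟ t ⌋)
      swap y = trans (∧-comm ⌊ R pt y ≟ t ⌋ (U (R y z))) (cong₂ _∧_ (cong U (symmetric y z)) (≟-symmetric pt y t))

  cnt⋃-shift : ∀ U → (∀ x y z → U (R x y) ≡ true → U (R y z) ≡ true → U (R x z) ≡ true) →
               ∀ s {w x} y → U (R w x) ≡ true → cnt⋃ U s x y ≡ cnt⋃ U s w y
  cnt⋃-shift U U-trans s {w} {x} y U[w,x] = count-cong λ z →
    cong (_∧ ⌊ R z y ≟ s ⌋) (bool-ext (U-trans w x z U[w,x]) (U-trans x w z U[x,w]))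
    where
    U[x,w] : U (R x w) ≡ true
    U[x,w] = trans (cong U (symmetric x w)) U[w,x]

+-cancel-⇔ : ∀ a {b c d e} → a + b + c ≡ a + d + e → (b ≡ d) ⇔ (c ≡ e)
+-cancel-⇔ a {b} {c} {d} {e} sums≡ = mk⇔
  (λ { refl → ℕₚ.+-cancelˡ-≡ (a + b) c e sums≡ })
  (λ { refl → ℕₚ.+-cancelˡ-≡ a b d (ℕₚ.+-cancelʳ-≡ c (a + b) (a + d) sums≡) })

*-cancelˡ-⇔ : ∀ {k a b} → k ≢ 0 → (k * a ≡ k * b) ⇔ (a ≡ b)
*-cancelˡ-⇔ {k} {a} {b} k≢0 = mk⇔ (ℕₚ.*-cancelˡ-≡ a b k {{≢-nonZero k≢0}}) (cong (k *_))

+-cancelʳ-⇔ : ∀ {a b c} → (a + c ≡ b + c) ⇔ (a ≡ b)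
+-cancelʳ-⇔ {a} {b} {c} = mk⇔ (ℕₚ.+-cancelʳ-≡ c a b) (cong (_+ c))

≡⇔≡ : ∀ {a} {A : Set a} {x x′ y y′ : A} → x ≡ x′ → y ≡ y′ → (x ≡ y) ⇔ (x′ ≡ y′)
≡⇔≡ refl refl = mk⇔ id id

≡-sym-⇔ : ∀ {a} {A : Set a} {x y : A} → (x ≡ y) ⇔ (y ≡ x)
≡-sym-⇔ = mk⇔ sym sym

-- Condition (d) with its denominators cleared, kept in ℕ and hence without subtraction. Here L
-- stands for c_{e₁3}³, and the hypothesis on m L is the double counting n₄ c_{e₁3}⁴ = n₃ c_{e₁4}³
-- combined with c_{e₁3}³ + c_{e₁4}³ = n₁ + n₂ + 1.
condD-ℕ : ∀ {n₁ n₂ n₃ n₄ L u v} → let m = n₃ + n₄ in m ≢ 0 →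
          L + u + v ≡ n₃ → m * L ≡ n₃ * suc (n₁ + n₂) →
          (n₄ * u ≡ n₃ * v) ⇔ (v * m * m + n₃ * n₄ * (n₂ + suc n₁) ≡ n₃ * n₄ * m)
condD-ℕ {n₁} {n₂} {n₃} {n₄} {L} {u} {v} m≢0 column mL≡ = begin
  (n₄ * u ≡ n₃ * v)                                           ∼⟨ ≡-sym-⇔ ⟩
  (n₃ * v ≡ n₄ * u)                                           ∼⟨ ⇔-sym +-cancelʳ-⇔ ⟩
  (n₃ * v + n₄ * (L + v) ≡ n₄ * u + n₄ * (L + v))             ∼⟨ ≡⇔≡ regroupˡ (trans regroupʳ (cong (n₄ *_) column)) ⟩
  (v * m + n₄ * L ≡ n₄ * n₃)                                  ∼⟨ ⇔-sym (*-cancelˡ-⇔ m≢0) ⟩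
  (m * (v * m + n₄ * L) ≡ m * (n₄ * n₃))                      ∼⟨ ≡⇔≡ scaled (solve 3 (λ n₃ n₄ m → m :* (n₄ :* n₃) := n₃ :* n₄ :* m) refl n₃ n₄ m) ⟩
  (v * m * m + n₃ * n₄ * (n₂ + suc n₁) ≡ n₃ * n₄ * m)         ∎
  where
  open Related.EquationalReasoning
  open +-*-Solver
  m = n₃ + n₄
  regroupˡ : n₃ * v + n₄ * (L + v) ≡ v * m + n₄ * L
  regroupˡ = solve 4 (λ n₃ n₄ L v → n₃ :* v :+ n₄ :* (L :+ v) := v :* (n₃ :+ n₄) :+ n₄ :* L) refl n₃ n₄ L v
  regroupʳ : n₄ * u + n₄ * (L + v) ≡ n₄ * (L + u + v)
  regroupʳ = solve 4 (λ n₄ L u v → n₄ :* u :+ n₄ :* (L :+ v) := n₄ :* (L :+ u :+ v)) refl n₄ L u v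
  scaled : m * (v * m + n₄ * L) ≡ v * m * m + n₃ * n₄ * (n₂ + suc n₁)
  scaled = ≡.begin
    m * (v * m + n₄ * L)                   ≡.≡⟨ solve 4 (λ m v n₄ L → m :* (v :* m :+ n₄ :* L) := v :* m :* m :+ n₄ :* (m :* L)) refl m v n₄ L ⟩
    v * m * m + n₄ * (m * L)               ≡.≡⟨ cong (λ x → v * m * m + n₄ * x) mL≡ ⟩
    v * m * m + n₄ * (n₃ * suc (n₁ + n₂))  ≡.≡⟨ solve 6 (λ v m n₁ n₂ n₃ n₄ → v :* m :* m :+ n₄ :* (n₃ :* (con 1 :+ (n₁ :+ n₂)))
                                                       := v :* m :* m :+ n₃ :* n₄ :* (n₂ :+ (con 1 :+ n₁))) refl v m n₁ n₂ n₃ n₄ ⟩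
    v * m * m + n₃ * n₄ * (n₂ + suc n₁)    ≡.∎
    where module ≡ = ≡-Reasoning

ι : ℕ → ℚ
ι a = ℤ.+ a ℚ./ 1

ι-+ : ∀ a b → ι (a + b) ≡ ι a ℚ.+ ι b
ι-+ a b = toℚᵘ-injective (begin
  toℚᵘ (ι (a + b))                          ≈⟨ toℚᵘ-fromℚᵘ (mkℚᵘ (ℤ.+ (a + b)) 0) ⟩
  mkℚᵘ (ℤ.+ (a + b)) 0                       ≈⟨ *≡* (cong (ℤ._* ℤ.+ 1) (sym (cong₂ ℤ._+_ (ℤₚ.*-identityʳ (ℤ.+ a)) (ℤₚ.*-identityʳ (ℤ.+ b))))) ⟩
  mkℚᵘ (ℤ.+ a) 0 ℚᵘ.+ mkℚᵘ (ℤ.+ b) 0              ≈⟨ ℚᵘₚ.+-cong (toℚᵘ-fromℚᵘ (mkℚᵘ (ℤ.+ a) 0)) (toℚᵘ-fromℚᵘ (mkℚᵘ (ℤ.+ b) 0)) ⟨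
  toℚᵘ (ι a) ℚᵘ.+ toℚᵘ (ι b)                  ≈⟨ toℚᵘ-homo-+ (ι a) (ι b) ⟨
  toℚᵘ (ι a ℚ.+ ι b)                          ∎)
  where open ℚᵘₚ.≃-Reasoning

ι-* : ∀ a b → ι (a * b) ≡ ι a ℚ.* ι b
ι-* a b = toℚᵘ-injective (begin
  toℚᵘ (ι (a * b))                          ≈⟨ toℚᵘ-fromℚᵘ (mkℚᵘ (ℤ.+ (a * b)) 0) ⟩
  mkℚᵘ (ℤ.+ (a * b)) 0                       ≈⟨ *≡* (cong (ℤ._* ℤ.+ 1) (ℤₚ.pos-* a b)) ⟩
  mkℚᵘ (ℤ.+ a) 0 ℚᵘ.* mkℚᵘ (ℤ.+ b) 0              ≈⟨ ℚᵘₚ.*-cong (toℚᵘ-fromℚᵘ (mkℚᵘ (ℤ.+ a) 0)) (toℚᵘ-fromℚᵘ (mkℚᵘ (ℤ.+ b) 0)) ⟨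
  toℚᵘ (ι a) ℚᵘ.* toℚᵘ (ι b)                  ≈⟨ toℚᵘ-homo-* (ι a) (ι b) ⟨
  toℚᵘ (ι a ℚ.* ι b)                          ∎)
  where open ℚᵘₚ.≃-Reasoning

/ₜ≡*1/ₜ : ∀ a {b} → b ≢ 0 → a /ₜ b ≡ ι a ℚ.* (1 /ₜ b)
/ₜ≡*1/ₜ a {zero}  b≢0 = ⊥-elim (b≢0 refl)
/ₜ≡*1/ₜ a {suc d} _   = toℚᵘ-injective (begin
  toℚᵘ (a /ₜ suc d)                            ≈⟨ toℚᵘ-fromℚᵘ (mkℚᵘ (ℤ.+ a) d) ⟩
  mkℚᵘ (ℤ.+ a) d                                 ≈⟨ *≡* (cong₂ (λ i j → i ℤ.* ℤ.+ suc j) (sym (ℤₚ.*-identityʳ (ℤ.+ a))) (ℕₚ.+-identityʳ d)) ⟩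
  mkℚᵘ (ℤ.+ a) 0 ℚᵘ.* mkℚᵘ (ℤ.+ 1) d               ≈⟨ ℚᵘₚ.*-cong (toℚᵘ-fromℚᵘ (mkℚᵘ (ℤ.+ a) 0)) (toℚᵘ-fromℚᵘ (mkℚᵘ (ℤ.+ 1) d)) ⟨
  toℚᵘ (ι a) ℚᵘ.* toℚᵘ (1 /ₜ suc d)            ≈⟨ toℚᵘ-homo-* (ι a) (1 /ₜ suc d) ⟨
  toℚᵘ (ι a ℚ.* (1 /ₜ suc d))                  ∎)
  where open ℚᵘₚ.≃-Reasoning

ι*1/ₜ≡1 : ∀ {b} → b ≢ 0 → ι b ℚ.* (1 /ₜ b) ≡ 1ℚ
ι*1/ₜ≡1 {zero}  b≢0 = ⊥-elim (b≢0 refl)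
ι*1/ₜ≡1 {suc d} _   = toℚᵘ-injective (begin
  toℚᵘ (ι (suc d) ℚ.* (1 /ₜ suc d))            ≈⟨ toℚᵘ-homo-* (ι (suc d)) (1 /ₜ suc d) ⟩
  toℚᵘ (ι (suc d)) ℚᵘ.* toℚᵘ (1 /ₜ suc d)      ≈⟨ ℚᵘₚ.*-cong (toℚᵘ-fromℚᵘ (mkℚᵘ (ℤ.+ suc d) 0)) (toℚᵘ-fromℚᵘ (mkℚᵘ (ℤ.+ 1) d)) ⟩
  mkℚᵘ (ℤ.+ suc d) 0 ℚᵘ.* mkℚᵘ (ℤ.+ 1) d           ≈⟨ *≡* (trans (ℤₚ.*-identityʳ _) (trans (ℤₚ.*-identityʳ (ℤ.+ suc d)) (sym (trans (ℤₚ.*-identityˡ _) (cong (λ j → ℤ.+ suc j) (ℕₚ.+-identityʳ d)))))) ⟩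
  mkℚᵘ (ℤ.+ 1) 0                                 ∎)
  where open ℚᵘₚ.≃-Reasoning

ι-injective : ∀ {a b} → ι a ≡ ι b → a ≡ b
ι-injective {a} {b} ιa≡ιb with ℚᵘₚ.≃-trans (ℚᵘₚ.≃-sym (toℚᵘ-fromℚᵘ (mkℚᵘ (ℤ.+ a) 0)))
                                  (ℚᵘₚ.≃-trans (toℚᵘ-cong ιa≡ιb) (toℚᵘ-fromℚᵘ (mkℚᵘ (ℤ.+ b) 0)))
... | *≡* a*1≡b*1 = ℤₚ.+-injective (trans (sym (ℤₚ.*-identityʳ (ℤ.+ a))) (trans a*1≡b*1 (ℤₚ.*-identityʳ (ℤ.+ b))))

ι-⇔ : ∀ {a b} → (ι a ≡ ι b) ⇔ (a ≡ b)
ι-⇔ = mk⇔ ι-injective (cong ι)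

module _ where
  open ℚ-Solver.+-*-Solver

  *-cancel-unit : ∀ {x y p q : ℚ} → x ℚ.* y ≡ 1ℚ → (p ≡ q) ⇔ (p ℚ.* x ≡ q ℚ.* x)
  *-cancel-unit {x} {y} {p} {q} xy≡1 = mk⇔ (cong (ℚ._* x)) cancel
    where
    open ≡-Reasoning
    cancel : p ℚ.* x ≡ q ℚ.* x → p ≡ q
    cancel px≡qx = begin
      p                    ≡⟨ solve 1 (λ p → p := p :* con 1ℚ) refl p ⟩
      p ℚ.* 1ℚ             ≡⟨ cong (p ℚ.*_) (sym xy≡1) ⟩
      p ℚ.* (x ℚ.* y)      ≡⟨ solve 3 (λ p x y → p :* (x :* y) := (p :* x) :* y) refl p x y ⟩
      (p ℚ.* x) ℚ.* y      ≡⟨ cong (ℚ._* y) px≡qx ⟩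
      (q ℚ.* x) ℚ.* y      ≡⟨ solve 3 (λ q x y → (q :* x) :* y := q :* (x :* y)) refl q x y ⟩
      q ℚ.* (x ℚ.* y)      ≡⟨ cong (q ℚ.*_) xy≡1 ⟩
      q ℚ.* 1ℚ             ≡⟨ solve 1 (λ q → q :* con 1ℚ := q) refl q ⟩
      q                    ∎

  ≡-⇔-+≡ : ∀ {p q r : ℚ} → (p ≡ q ℚ.- r) ⇔ (p ℚ.+ r ≡ q)
  ≡-⇔-+≡ {p} {q} {r} = mk⇔
    (λ e → trans (cong (ℚ._+ r) e) (solve 2 (λ q r → q :- r :+ r := q) refl q r))
    (λ e → trans (solve 2 (λ p r → p := p :+ r :- r) refl p r) (cong (ℚ._- r) e))

module ConditionD {n} (X : Scheme n 4) where
  open Scheme X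
  open Params X
  open ℚ-Solver.+-*-Solver

  m : ℕ
  m = n₃ + n₄

  A N₂ N₃ N₄ M q r : ℚ
  A  = ι (suc n₁)
  N₂ = ι n₂
  N₃ = ι n₃
  N₄ = ι n₄
  M  = N₃ ℚ.+ N₄
  q  = 1 /ₜ suc n₁
  r  = 1 /ₜ m

  ιm≡M : ι m ≡ M
  ιm≡M = ι-+ n₃ n₄

  Aq≡1 : A ℚ.* q ≡ 1ℚ
  Aq≡1 = ι*1/ₜ≡1 {suc n₁} (λ ())

  β≡ : β ≡ N₂ ℚ.* q
  β≡ = /ₜ≡*1/ₜ n₂ {suc n₁} (λ ())

  ι-lhs : ι (c s4 s3 s4 * m * m + n₃ * n₄ * (n₂ + suc n₁))
          ≡ τ ℚ.* (M ℚ.* M) ℚ.+ N₃ ℚ.* N₄ ℚ.* (N₂ ℚ.+ A)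
  ι-lhs = begin
    ι (c s4 s3 s4 * m * m + n₃ * n₄ * (n₂ + suc n₁))
      ≡⟨ ι-+ (c s4 s3 s4 * m * m) (n₃ * n₄ * (n₂ + suc n₁)) ⟩
    ι (c s4 s3 s4 * m * m) ℚ.+ ι (n₃ * n₄ * (n₂ + suc n₁))
      ≡⟨ cong₂ ℚ._+_ (trans (ι-* (c s4 s3 s4 * m) m) (cong₂ ℚ._*_ (ι-* (c s4 s3 s4) m) ιm≡M))
                     (trans (ι-* (n₃ * n₄) (n₂ + suc n₁)) (cong₂ ℚ._*_ (ι-* n₃ n₄) (ι-+ n₂ (suc n₁)))) ⟩
    τ ℚ.* ι m ℚ.* M ℚ.+ N₃ ℚ.* N₄ ℚ.* (N₂ ℚ.+ A)
      ≡⟨ cong (λ x → τ ℚ.* x ℚ.* M ℚ.+ N₃ ℚ.* N₄ ℚ.* (N₂ ℚ.+ A)) ιm≡M ⟩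
    τ ℚ.* M ℚ.* M ℚ.+ N₃ ℚ.* N₄ ℚ.* (N₂ ℚ.+ A)
      ≡⟨ cong (ℚ._+ N₃ ℚ.* N₄ ℚ.* (N₂ ℚ.+ A)) (solve 2 (λ t M → t :* M :* M := t :* (M :* M)) refl τ M) ⟩
    τ ℚ.* (M ℚ.* M) ℚ.+ N₃ ℚ.* N₄ ℚ.* (N₂ ℚ.+ A)
      ∎
    where open ≡-Reasoning

  ι-rhs : ι (n₃ * n₄ * m) ≡ N₃ ℚ.* N₄ ℚ.* M
  ι-rhs = trans (ι-* (n₃ * n₄) m) (cong₂ ℚ._*_ (ι-* n₃ n₄) ιm≡M)

  module _ (m≢0 : m ≢ 0) where

    Mr≡1 : M ℚ.* r ≡ 1ℚ
    Mr≡1 = trans (cong (ℚ._* r) (sym ιm≡M)) (ι*1/ₜ≡1 m≢0)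

    MM*rr≡1 : (M ℚ.* M) ℚ.* (r ℚ.* r) ≡ 1ℚ
    MM*rr≡1 = begin
      (M ℚ.* M) ℚ.* (r ℚ.* r)   ≡⟨ solve 2 (λ M r → (M :* M) :* (r :* r) := (M :* r) :* (M :* r)) refl M r ⟩
      (M ℚ.* r) ℚ.* (M ℚ.* r)   ≡⟨ cong₂ ℚ._*_ Mr≡1 Mr≡1 ⟩
      1ℚ ℚ.* 1ℚ                 ≡⟨ solve 0 (con 1ℚ :* con 1ℚ := con 1ℚ) refl ⟩
      1ℚ                        ∎
      where open ≡-Reasoning

    γ≡ : γ ≡ N₃ ℚ.* A ℚ.* r
    γ≡ = trans (/ₜ≡*1/ₜ (n₃ * suc n₁) m≢0) (cong (ℚ._* r) (ι-* n₃ (suc n₁)))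

    δ≡ : δ ≡ M ℚ.* q
    δ≡ = trans (/ₜ≡*1/ₜ m {suc n₁} (λ ())) (cong (ℚ._* q) ιm≡M)

    -- In the variables A q M r the identity below is polynomial; the units A q and M r are then set to 1.
    rhs-scaled : ((ε ℚ.* γ ℚ.* (α ℚ.- γ)) ℚ.* q) ℚ.* (M ℚ.* M) ≡ N₃ ℚ.* N₄ ℚ.* M ℚ.- N₃ ℚ.* N₄ ℚ.* (N₂ ℚ.+ A)
    rhs-scaled = begin
      ((ε ℚ.* γ ℚ.* (α ℚ.- γ)) ℚ.* q) ℚ.* (M ℚ.* M)
        ≡⟨ cong₂ (λ b g → (((δ ℚ.- b ℚ.- 1ℚ) ℚ.* g ℚ.* (A ℚ.- g)) ℚ.* q) ℚ.* (M ℚ.* M)) β≡ γ≡ ⟩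
      ((((δ ℚ.- N₂ ℚ.* q ℚ.- 1ℚ) ℚ.* (N₃ ℚ.* A ℚ.* r) ℚ.* (A ℚ.- N₃ ℚ.* A ℚ.* r)) ℚ.* q) ℚ.* (M ℚ.* M))
        ≡⟨ cong (λ d → (((d ℚ.- N₂ ℚ.* q ℚ.- 1ℚ) ℚ.* (N₃ ℚ.* A ℚ.* r) ℚ.* (A ℚ.- N₃ ℚ.* A ℚ.* r)) ℚ.* q) ℚ.* (M ℚ.* M)) δ≡ ⟩
      ((((M ℚ.* q ℚ.- N₂ ℚ.* q ℚ.- 1ℚ) ℚ.* (N₃ ℚ.* A ℚ.* r) ℚ.* (A ℚ.- N₃ ℚ.* A ℚ.* r)) ℚ.* q) ℚ.* (M ℚ.* M))
        ≡⟨ solve 6 (λ N₂ N₃ N₄ A q r →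
             ((((N₃ :+ N₄) :* q :- N₂ :* q :- con 1ℚ) :* (N₃ :* A :* r) :* (A :- N₃ :* A :* r)) :* q) :* ((N₃ :+ N₄) :* (N₃ :+ N₄))
             := N₃ :* ((N₃ :+ N₄) :* r) :* (A :* q) :* ((N₃ :+ N₄) :- N₃ :* ((N₃ :+ N₄) :* r)) :* (((N₃ :+ N₄) :- N₂) :* (A :* q) :- A))
             refl N₂ N₃ N₄ A q r ⟩
      N₃ ℚ.* (M ℚ.* r) ℚ.* (A ℚ.* q) ℚ.* (M ℚ.- N₃ ℚ.* (M ℚ.* r)) ℚ.* ((M ℚ.- N₂) ℚ.* (A ℚ.* q) ℚ.- A)
        ≡⟨ cong₂ (λ u v → N₃ ℚ.* u ℚ.* v ℚ.* (M ℚ.- N₃ ℚ.* u) ℚ.* ((M ℚ.- N₂) ℚ.* v ℚ.- A)) Mr≡1 Aq≡1 ⟩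
      N₃ ℚ.* 1ℚ ℚ.* 1ℚ ℚ.* (M ℚ.- N₃ ℚ.* 1ℚ) ℚ.* ((M ℚ.- N₂) ℚ.* 1ℚ ℚ.- A)
        ≡⟨ solve 4 (λ N₂ N₃ N₄ A →
             N₃ :* con 1ℚ :* con 1ℚ :* ((N₃ :+ N₄) :- N₃ :* con 1ℚ) :* (((N₃ :+ N₄) :- N₂) :* con 1ℚ :- A)
             := N₃ :* N₄ :* (N₃ :+ N₄) :- N₃ :* N₄ :* (N₂ :+ A))
             refl N₂ N₃ N₄ A ⟩
      N₃ ℚ.* N₄ ℚ.* M ℚ.- N₃ ℚ.* N₄ ℚ.* (N₂ ℚ.+ A)
        ∎
      where open ≡-Reasoning

    CondD⇔ : CondD ⇔ (c s4 s3 s4 * m * m + n₃ * n₄ * (n₂ + suc n₁) ≡ n₃ * n₄ * m)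
    CondD⇔ = begin
      CondD                                                                 ∼⟨ *-cancel-unit MM*rr≡1 ⟩
      (τ ℚ.* (M ℚ.* M) ≡ (ε ℚ.* γ ℚ.* (α ℚ.- γ)) ℚ.* q ℚ.* (M ℚ.* M))       ∼⟨ ≡⇔≡ refl rhs-scaled ⟩
      (τ ℚ.* (M ℚ.* M) ≡ N₃ ℚ.* N₄ ℚ.* M ℚ.- N₃ ℚ.* N₄ ℚ.* (N₂ ℚ.+ A))       ∼⟨ ≡-⇔-+≡ ⟩
      (τ ℚ.* (M ℚ.* M) ℚ.+ N₃ ℚ.* N₄ ℚ.* (N₂ ℚ.+ A) ≡ N₃ ℚ.* N₄ ℚ.* M)       ∼⟨ ≡⇔≡ (sym ι-lhs) (sym ι-rhs) ⟩
      (ι (c s4 s3 s4 * m * m + n₃ * n₄ * (n₂ + suc n₁)) ≡ ι (n₃ * n₄ * m))  ∼⟨ ι-⇔ ⟩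
      (c s4 s3 s4 * m * m + n₃ * n₄ * (n₂ + suc n₁) ≡ n₃ * n₄ * m)          ∎
      where open Related.EquationalReasoning

module Higmanian {n} (X : Scheme n 4) (H : HigmanianStd X) where
  open Scheme X
  open HigmanianStd H
  open Params X
  open SymmetricScheme X symmetric
  open ConditionD X using (CondD⇔)

  E₁ : Fin 5 → Bool
  E₁ zero = true
  E₁ s1   = true
  E₁ s2   = true
  E₁ s3   = false
  E₁ s4   = false

  e₁ : Rel
  e₁ x y = E₁ (R x y) ≡ true

  E₁-sound : ∀ i → E₁ i ≡ true → i ≡ zero ⊎ i ≡ s1 ⊎ i ≡ s2
  E₁-sound zero _ = inj₁ refl
  E₁-sound s1   _ = inj₂ (inj₁ refl)
  E₁-sound s2   _ = inj₂ (inj₂ refl)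
  E₁-sound s3   ()
  E₁-sound s4   ()

  E₁-complete : ∀ {i} → i ≡ zero ⊎ i ≡ s1 ⊎ i ≡ s2 → E₁ i ≡ true
  E₁-complete (inj₁ refl)        = refl
  E₁-complete (inj₂ (inj₁ refl)) = refl
  E₁-complete (inj₂ (inj₂ refl)) = refl

  E₁-false : ∀ {i} → E₁ i ≡ false → i ≡ s3 ⊎ i ≡ s4
  E₁-false {s3} _ = inj₁ refl
  E₁-false {s4} _ = inj₂ refl

  E₁-refl : ∀ x → E₁ (R x x) ≡ true
  E₁-refl x = cong E₁ (R-diagonal x)

  E₁-sym : ∀ {x y} → E₁ (R x y) ≡ true → E₁ (R y x) ≡ true
  E₁-sym {x} {y} = trans (cong E₁ (symmetric y x))

  E₁-trans : ∀ x y z → E₁ (R x y) ≡ true → E₁ (R y z) ≡ true → E₁ (R x z) ≡ true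
  E₁-trans x y z E₁[x,y] E₁[y,z] =
    E₁-complete (proj₂ (proj₂ e₁-parabolic) x y z (E₁-sound _ E₁[x,y]) (E₁-sound _ E₁[y,z]))

  cE : Fin 5 → Fin 5 → ℕ
  cE = c⋃ E₁

  -- The sums over Fin 5 unfold definitionally into the terms given to the solver.
  column : ∀ s t → cE s t + c s3 s t + c s4 s t ≡ val s
  column s t = begin
    cE s t + c s3 s t + c s4 s t                           ≡⟨ cong (λ e → e + c s3 s t + c s4 s t) (cnt⋃≡∑ E₁ s (x₀ t) (y₀ t)) ⟩
    ∑[ i < 5 ] (𝟙 (E₁ i) * c i s t) + c s3 s t + c s4 s t   ≡⟨ solve 5 (λ c₀ c₁ c₂ c₃ c₄ →
                                                                (c₀ :+ con 0 :+ (c₁ :+ con 0 :+ (c₂ :+ con 0 :+ (con 0 :+ (con 0 :+ con 0))))) :+ c₃ :+ c₄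
                                                                := c₀ :+ (c₁ :+ (c₂ :+ (c₃ :+ (c₄ :+ con 0)))))
                                                              refl (c zero s t) (c s1 s t) (c s2 s t) (c s3 s t) (c s4 s t) ⟩
    ∑[ i < 5 ] c i s t                                     ≡⟨ ∑c≡val s t ⟩
    val s                                                  ∎
    where
    open +-*-Solver
    open ≡-Reasoning

  E₁-valency : ∀ x → count (λ z → E₁ (R x z)) ≡ suc (n₁ + n₂)
  E₁-valency x = begin
    count (λ z → E₁ (R x z))                       ≡⟨ count⋃-valency E₁ x ⟩
    ∑[ i < 5 ] (𝟙 (E₁ i) * val i)                  ≡⟨ cong (λ v → v + 0 + (n₁ + 0 + (n₂ + 0 + (0 + (0 + 0))))) valency-diagonal ⟩
    1 + 0 + (n₁ + 0 + (n₂ + 0 + (0 + (0 + 0))))   ≡⟨ solve 2 (λ n₁ n₂ → con 1 :+ con 0 :+ (n₁ :+ con 0 :+ (n₂ :+ con 0 :+ (con 0 :+ (con 0 :+ con 0))))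
                                                              := con 1 :+ (n₁ :+ n₂)) refl n₁ n₂ ⟩
    suc (n₁ + n₂)                                 ∎
    where
    open +-*-Solver
    open ≡-Reasoning

  cE₃+cE₄ : ∀ {t} → E₁ t ≡ false → cE s3 t + cE s4 t ≡ suc (n₁ + n₂)
  cE₃+cE₄ {t} E₁[t] = trans (count-+ _ _ _ (λ z → split (E₁ (R x z)) (R z y) (no-return z))) (E₁-valency x)
    where
    x = x₀ t
    y = y₀ t
    no-return : ∀ z → E₁ (R x z) ≡ true → E₁ (R z y) ≡ true → ⊥
    no-return z E₁[x,z] E₁[z,y] with () ← trans (sym E₁[t]) (trans (cong E₁ (sym (R[x₀,y₀] t))) (E₁-trans x z y E₁[x,z] E₁[z,y]))
    split : ∀ b j → (b ≡ true → E₁ j ≡ true → ⊥) → 𝟙 (b ∧ ⌊ j ≟ s3 ⌋) + 𝟙 (b ∧ ⌊ j ≟ s4 ⌋) ≡ 𝟙 b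
    split false j _         = refl
    split true  zero no-ret = ⊥-elim (no-ret refl refl)
    split true  s1   no-ret = ⊥-elim (no-ret refl refl)
    split true  s2   no-ret = ⊥-elim (no-ret refl refl)
    split true  s3   _      = refl
    split true  s4   _      = refl

  cE₃⁴≢0 : cE s3 s4 ≢ 0
  cE₃⁴≢0 cE₃⁴≡0 = 0≢1+n (trans (sym (Equivalence.from (diagonal (x₀ s1) (y₀ s1)) x≡y)) (R[x₀,y₀] s1))
    where
    e₁∘s₃⊆s₃ : ∀ {x w y} → E₁ (R x w) ≡ true → R w y ≡ s3 → R x y ≡ s3
    e₁∘s₃⊆s₃ {x} {w} {y} E₁[x,w] R[w,y] with E₁ (R x y) in E₁[x,y]
    ... | true with () ← trans (cong E₁ (sym R[w,y])) (E₁-trans w x y (E₁-sym E₁[x,w]) E₁[x,y])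
    ... | false with E₁-false E₁[x,y]
    ...   | inj₁ R[x,y]≡s3 = R[x,y]≡s3
    ...   | inj₂ R[x,y]≡s4 = ⊥-elim (count≢0 _ {w} w-between (trans (cnt⋃-regular E₁ s3 R[x,y]≡s4) cE₃⁴≡0))
      where
      w-between : (E₁ (R x w) ∧ ⌊ R w y ≟ s3 ⌋) ≡ true
      w-between = cong₂ _∧_ E₁[x,w] (trans (cong (λ i → ⌊ i ≟ s3 ⌋) R[w,y]) (≟-refl {5} s3))
    e₁∘s₃≐s₃ : (e₁ ∘ᵣ basis s3) ≐ basis s3
    e₁∘s₃≐s₃ x y = mk⇔ (λ (w , E₁[x,w] , R[w,y]) → e₁∘s₃⊆s₃ E₁[x,w] R[w,y]) (λ R[x,y] → x , E₁-refl x , R[x,y])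
    s₃∘e₁≐s₃ : (basis s3 ∘ᵣ e₁) ≐ basis s3
    s₃∘e₁≐s₃ x y = mk⇔ (λ (w , R[x,w] , E₁[w,y]) → trans (symmetric x y) (e₁∘s₃⊆s₃ (E₁-sym E₁[w,y]) (trans (symmetric w x) R[x,w])))
                       (λ R[x,y] → y , R[x,y] , E₁-refl y)
    x≡y : x₀ s1 ≡ y₀ s1
    x≡y = rad₃ e₁ e₁∘s₃≐s₃ s₃∘e₁≐s₃ (x₀ s1) (y₀ s1) (cong E₁ (R[x₀,y₀] s1))

  cE₃⁴≡cE₃³ : cE s3 s4 ≡ cE s3 s3
  cE₃⁴≡cE₃³ with count-witness _ cE₃⁴≢0
  ... | w , between with ∧-true (E₁ (R (x₀ s4) w)) between
  ...   | E₁[x,w] , R[w,y] = begin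
    cnt⋃ E₁ s3 (x₀ s4) (y₀ s4) ≡⟨ cnt⋃-shift E₁ E₁-trans s3 (y₀ s4) (E₁-sym E₁[x,w]) ⟩
    cnt⋃ E₁ s3 w (y₀ s4)       ≡⟨ cnt⋃-regular E₁ s3 (≟-sound R[w,y]) ⟩
    cE s3 s3                  ∎
    where open ≡-Reasoning

  cE₄⁴≡cE₄³ : cE s4 s4 ≡ cE s4 s3
  cE₄⁴≡cE₄³ = ℕₚ.+-cancelˡ-≡ (cE s3 s3) (cE s4 s4) (cE s4 s3)
    (trans (cong (_+ cE s4 s4) (sym cE₃⁴≡cE₃³)) (trans (cE₃+cE₄ refl) (sym (cE₃+cE₄ refl))))

  column₃⁴ : cE s3 s3 + c s3 s3 s4 + c s4 s3 s4 ≡ n₃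
  column₃⁴ = trans (cong (λ l → l + c s3 s3 s4 + c s4 s3 s4) (sym cE₃⁴≡cE₃³)) (column s3 s4)

  column₄ : ∀ t → cE s4 t ≡ cE s4 s3 → cE s4 s3 + c s4 s3 t + c s4 s4 t ≡ n₄
  column₄ t cE₄ᵗ≡cE₄³ =
    trans (cong₂ (λ l v → l + v + c s4 s4 t) (sym cE₄ᵗ≡cE₄³) (c-comm s4 s3 t)) (column s4 t)

  n₃≢0 : n₃ ≢ 0
  n₃≢0 = count≢0 (λ z → ⌊ R (x₀ s3) z ≟ s3 ⌋) {y₀ s3} (trans (cong (λ i → ⌊ i ≟ s3 ⌋) (R[x₀,y₀] s3)) (≟-refl {5} s3))
         ∘ trans (valency (x₀ s3) s3)

  n₃+n₄≢0 : n₃ + n₄ ≢ 0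
  n₃+n₄≢0 = n₃≢0 ∘ ℕₚ.m+n≡0⇒m≡0 n₃

  n₄*c₃₃⁴≡n₃*c₄₃³ : n₄ * c s3 s3 s4 ≡ n₃ * c s4 s3 s3
  n₄*c₃₃⁴≡n₃*c₄₃³ = trans (val-*-c⋃ ⁅ s3 ⁆ s3 s4) (cong (n₃ *_) (c-comm s3 s4 s3))

  m*cE₃³ : (n₃ + n₄) * cE s3 s3 ≡ n₃ * suc (n₁ + n₂)
  m*cE₃³ = begin
    (n₃ + n₄) * cE s3 s3                ≡⟨ ℕₚ.*-distribʳ-+ (cE s3 s3) n₃ n₄ ⟩
    n₃ * cE s3 s3 + n₄ * cE s3 s3       ≡⟨ cong (λ l → n₃ * cE s3 s3 + n₄ * l) (sym cE₃⁴≡cE₃³) ⟩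
    n₃ * cE s3 s3 + n₄ * cE s3 s4       ≡⟨ cong (n₃ * cE s3 s3 +_) (val-*-c⋃ E₁ s3 s4) ⟩
    n₃ * cE s3 s3 + n₃ * cE s4 s3       ≡⟨ ℕₚ.*-distribˡ-+ n₃ (cE s3 s3) (cE s4 s3) ⟨
    n₃ * (cE s3 s3 + cE s4 s3)          ≡⟨ cong (n₃ *_) (cE₃+cE₄ refl) ⟩
    n₃ * suc (n₁ + n₂)                  ∎
    where open ≡-Reasoning

  a⇔b : (c s3 s3 s3 ≡ c s3 s3 s4) ⇔ (c s4 s3 s3 ≡ c s4 s3 s4)
  a⇔b = +-cancel-⇔ (cE s3 s3) (trans (column s3 s3) (sym column₃⁴))

  b⇔c : (c s4 s3 s3 ≡ c s4 s3 s4) ⇔ (c s4 s4 s3 ≡ c s4 s4 s4)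
  b⇔c = +-cancel-⇔ (cE s4 s3) (trans (column₄ s3 refl) (sym (column₄ s4 cE₄⁴≡cE₄³)))

  b⇔d : (c s4 s3 s3 ≡ c s4 s3 s4) ⇔ CondD
  b⇔d = begin
    (c s4 s3 s3 ≡ c s4 s3 s4)                          ∼⟨ ⇔-sym (*-cancelˡ-⇔ n₃≢0) ⟩
    (n₃ * c s4 s3 s3 ≡ n₃ * c s4 s3 s4)                ∼⟨ ≡⇔≡ (sym n₄*c₃₃⁴≡n₃*c₄₃³) refl ⟩
    (n₄ * c s3 s3 s4 ≡ n₃ * c s4 s3 s4)                ∼⟨ condD-ℕ n₃+n₄≢0 column₃⁴ m*cE₃³ ⟩
    (c s4 s3 s4 * m * m + n₃ * n₄ * (n₂ + suc n₁) ≡ n₃ * n₄ * m) ∼⟨ ⇔-sym (CondD⇔ n₃+n₄≢0) ⟩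
    CondD                                              ∎
    where
    open Related.EquationalReasoning
    m = n₃ + n₄

lemma3p2 : ∀ {n} (X : Scheme n 4) → HigmanianStd X →
           let open Scheme X in
           let open Params X in
           ((c s3 s3 s3 ≡ c s3 s3 s4) ⇔ (c s4 s3 s3 ≡ c s4 s3 s4))
           × ((c s3 s3 s3 ≡ c s3 s3 s4) ⇔ (c s4 s4 s3 ≡ c s4 s4 s4))
           × ((c s3 s3 s3 ≡ c s3 s3 s4) ⇔ CondD)
lemma3p2 X H = a⇔b , ⇔-trans a⇔b b⇔c , ⇔-trans a⇔b b⇔d
  where open Higmanian X H
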